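{- Let $G$ be a minimal counterexample as described in the context. If $uv$ is an edge of $G$ and $d(u)\le 4$, then $d(u)+d(v)\ge 10$.
   Context: A total $9$-coloring of a graph assigns to every vertex and every edge one of $9$ colors so that adjacent vertices, edges sharing an endpoint, and a vertex and an edge incident to it all receive different colors. A $4$-fan is a path $x_1x_2x_3x_4x_5$ together with one further vertex adjacent to all of $x_1,\dots,x_5$. A minimal counterexample is a simple planar graph $G$ of maximum degree $8$ containing no subgraph isomorphic to a $4$-fan, having no total $9$-coloring, with $|V(G)|+|E(G)|$ minimum among all such graphs; as part of this standing assumption, for every $x\in V(G)\cup E(G)$ the graph $G-x$ admits a total $9$-coloring. $d(v)$ denotes the degree of $v$. -}

module Defs where

open import Data.Nat using (ℕ; zero; suc; pred; _+_; _≤_; _<ᵇ_)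
open import Data.Fin using (Fin; toℕ; punchIn; _≟_)
open import Data.Fin.Patterns using (0F; 1F; 2F; 3F; 4F; 5F)
open import Data.Bool using (Bool; true; false; _∧_; _∨_; not; if_then_else_)
open import Data.Bool.Properties using (∧-comm; ∨-comm)
open import Data.List using (List; map; allFin)
open import Data.Nat.ListAction using (sum)
open import Data.Product using (Σ; ∃; _×_; _,_)
open import Data.Sum using (_⊎_)
open import Data.Rational using (ℚ; 0ℚ; 1ℚ) renaming (_≤_ to _≤ℚ_; _+_ to _+ℚ_; _-_ to _-ℚ_; _*_ to _*ℚ_)
open import Relation.Nullary using (¬_; ⌊_⌋)
open import Relation.Binary.PropositionalEquality using (_≡_; _≢_; refl; cong; cong₂; trans)
open import Function.Definitions using (Injective)

record Graph (n : ℕ) : Set where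
  field
    adj    : Fin n → Fin n → Bool
    sym    : ∀ u v → adj u v ≡ adj v u
    irrefl : ∀ v → adj v v ≡ false
open Graph public

Adj : ∀ {n} → Graph n → Fin n → Fin n → Set
Adj G u v = adj G u v ≡ true

deg : ∀ {n} → Graph n → Fin n → ℕ
deg {n} G v = sum (map (λ w → if adj G v w then 1 else 0) (allFin n))

edgeCount : ∀ {n} → Graph n → ℕ
edgeCount {n} G =
  sum (map (λ i → sum (map (λ j → if (toℕ i <ᵇ toℕ j) ∧ adj G i j then 1 else 0)
                            (allFin n)))
           (allFin n))

size : ∀ {n} → Graph n → ℕ
size {n} G = n + edgeCount G

MaxDegree : ∀ {n} → Graph n → ℕ → Set
MaxDegree G Δ = (∀ v → deg G v ≤ Δ) × ∃ λ v → deg G v ≡ Δ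

deleteVertex : ∀ {n} → Graph n → Fin n → Graph (pred n)
deleteVertex {suc m} G x = record
  { adj    = λ i j → adj G (punchIn x i) (punchIn x j)
  ; sym    = λ i j → sym G (punchIn x i) (punchIn x j)
  ; irrefl = λ i → irrefl G (punchIn x i)
  }

sameEdge : ∀ {n} → Fin n → Fin n → Fin n → Fin n → Bool
sameEdge a b u v = (⌊ u ≟ a ⌋ ∧ ⌊ v ≟ b ⌋) ∨ (⌊ u ≟ b ⌋ ∧ ⌊ v ≟ a ⌋)

sameEdge-sym : ∀ {n} (a b u v : Fin n) → sameEdge a b u v ≡ sameEdge a b v u
sameEdge-sym a b u v =
  trans (cong₂ _∨_ (∧-comm ⌊ u ≟ a ⌋ ⌊ v ≟ b ⌋) (∧-comm ⌊ u ≟ b ⌋ ⌊ v ≟ a ⌋))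
        (∨-comm (⌊ v ≟ b ⌋ ∧ ⌊ u ≟ a ⌋) (⌊ v ≟ a ⌋ ∧ ⌊ u ≟ b ⌋))

deleteEdge : ∀ {n} → Graph n → Fin n → Fin n → Graph n
deleteEdge G a b = record
  { adj    = λ u v → adj G u v ∧ not (sameEdge a b u v)
  ; sym    = λ u v → cong₂ _∧_ (sym G u v) (cong not (sameEdge-sym a b u v))
  ; irrefl = λ v → cong (_∧ _) (irrefl G v)
  }

record TotalColoring (k : ℕ) {n : ℕ} (G : Graph n) : Set where
  field
    vcol : Fin n → Fin k
    ecol : Fin n → Fin n → Fin k
    ecol-sym  : ∀ u v → Adj G u v → ecol u v ≡ ecol v u
    vv-proper : ∀ u v → Adj G u v → vcol u ≢ vcol v
    ee-proper : ∀ u v w → Adj G u v → Adj G u w → v ≢ w → ecol u v ≢ ecol u w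
    ve-proper : ∀ u v → Adj G u v → ecol u v ≢ vcol u

TotalColorable : ℕ → ∀ {n} → Graph n → Set
TotalColorable k G = TotalColoring k G

-- 4-fans: path x1..x5 (images of 0F..4F) plus a vertex (5F) adjacent to all

ContainsFourFan : ∀ {n} → Graph n → Set
ContainsFourFan {n} G =
  Σ (Fin 6 → Fin n) λ f → Injective _≡_ _≡_ f
    × Adj G (f 0F) (f 1F) × Adj G (f 1F) (f 2F) × Adj G (f 2F) (f 3F) × Adj G (f 3F) (f 4F)
    × Adj G (f 5F) (f 0F) × Adj G (f 5F) (f 1F) × Adj G (f 5F) (f 2F)
    × Adj G (f 5F) (f 3F) × Adj G (f 5F) (f 4F)

-- Planarity, via straight-line embeddings with rational coordinates
-- (equivalent to planarity for simple graphs by Fáry's theorem plus perturbation)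

Point : Set
Point = ℚ × ℚ

OnSegment : Point → Point → Point → Set
OnSegment (p₁ , p₂) (q₁ , q₂) (r₁ , r₂) =
  Σ ℚ λ t → (0ℚ ≤ℚ t) × (t ≤ℚ 1ℚ)
    × (r₁ ≡ p₁ +ℚ (t *ℚ (q₁ -ℚ p₁))) × (r₂ ≡ p₂ +ℚ (t *ℚ (q₂ -ℚ p₂)))

record StraightLineEmbedding {n : ℕ} (G : Graph n) : Set where
  field
    pos : Fin n → Point
    pos-injective : Injective _≡_ _≡_ pos
    vertex-off-edge : ∀ a b w → Adj G a b → OnSegment (pos a) (pos b) (pos w)
                      → (w ≡ a) ⊎ (w ≡ b)
    edges-disjoint : ∀ a b c d → Adj G a b → Adj G c d
                     → ¬ (((a ≡ c) × (b ≡ d)) ⊎ ((a ≡ d) × (b ≡ c)))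
                     → ∀ r → OnSegment (pos a) (pos b) r → OnSegment (pos c) (pos d) r
                     → ∃ λ w → (r ≡ pos w) × ((w ≡ a) ⊎ (w ≡ b)) × ((w ≡ c) ⊎ (w ≡ d))

Planar : ∀ {n} → Graph n → Set
Planar G = StraightLineEmbedding G

InClass : ∀ {n} → Graph n → Set
InClass G = Planar G × MaxDegree G 8 × ¬ ContainsFourFan G × ¬ TotalColorable 9 G

record MinimalCounterexample {n : ℕ} (G : Graph n) : Set where
  field
    planar       : Planar G
    maxDegree    : MaxDegree G 8
    noFourFan    : ¬ ContainsFourFan G
    notColorable : ¬ TotalColorable 9 G
    minimal      : ∀ {m} (H : Graph m) → InClass H → size G ≤ size H
    vertexDeletion : ∀ v → TotalColorable 9 (deleteVertex G v)
    edgeDeletion   : ∀ a b → Adj G a b → TotalColorable 9 (deleteEdge G a b)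

{-# OPTIONS --safe #-}
-- Suppose d(u) + d(v) ≤ 9 with d(u) ≤ 4, and take a total 9-colouring of G − uv.  Give uv a
-- colour α missing at v and on the other edges at u and at v: at most d(u) + d(v) − 1 ≤ 8
-- colours are excluded.  Then recolour u with a colour β avoiding α, v, the other edges at u and
-- the other neighbours of u: at most 2 d(u) ≤ 8 colours.  This totally 9-colours G.
module Submission where

open import Defs
open import Data.Bool using (Bool; true; false; T; _∧_; if_then_else_) renaming (_≟_ to _≟ᵇ_)
open import Data.Bool.Properties using (T-≡; T-∧; T-∨; ¬-not)
open import Data.Empty using (⊥-elim)
open import Data.Fin using (Fin; _≟_)
open import Data.Fin.Properties using (pigeonhole; all?; ¬∀⟶∃¬; <⇒≢)
open import Data.List using (List; []; _∷_; map; _++_; length; filter; allFin; lookup)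
open import Data.List.Properties using (length-++; length-map; filter-notAll)
open import Data.List.Membership.Propositional using (_∈_; _∉_)
open import Data.List.Membership.Propositional.Properties
  using (∈-map⁺; ∈-++⁺ˡ; ∈-++⁺ʳ; ∈-allFin; ∈-filter⁺)
open import Data.List.Relation.Unary.Any using (here; there; index; any?)
import Data.List.Relation.Unary.Any as Any
open import Data.List.Relation.Unary.Any.Properties using (lookup-index)
open import Data.Nat using (suc; _+_; _≤_; _<_; s≤s)
open import Data.Nat.ListAction using (sum)
open import Data.Nat.Properties using (+-suc; +-mono-≤; ≤-trans; ≰⇒>)
open import Data.Product using (∃; _×_; _,_; proj₂)
import Data.Product as Product
open import Data.Sum using (_⊎_; inj₁; inj₂)
import Data.Sum as Sum
open import Data.Vec.Functional using (updateAt)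
open import Data.Vec.Functional.Properties using (updateAt-updates; updateAt-minimal)
open import Function using (const; Equivalence)
open import Relation.Nullary using (¬_; Dec; yes; no; ¬?; ⌊_⌋)
open import Relation.Nullary.Decidable using (toWitness; fromWitness)
open import Relation.Binary.PropositionalEquality
  using (_≡_; _≢_; refl; trans; cong; cong₂; subst; subst₂; ≢-sym; module ≡-Reasoning)
import Relation.Binary.PropositionalEquality as ≡

open Equivalence using (to; from)

unusedColour : ∀ {k} (L : List (Fin k)) → length L < k → ∃ λ c → c ∉ L
unusedColour {k} L |L|<k with all? (λ c → any? (c ≟_) L)
... | no ¬all = ¬∀⟶∃¬ k (_∈ L) (λ c → any? (c ≟_) L) ¬all
... | yes all with i , j , i<j , sameIndex ← pigeonhole |L|<k (λ c → index (all c))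
  = ⊥-elim (<⇒≢ i<j (begin
      i                         ≡⟨ lookup-index (all i) ⟩
      lookup L (index (all i))  ≡⟨ cong (lookup L) sameIndex ⟩
      lookup L (index (all j))  ≡⟨ lookup-index (all j) ⟨
      j                         ∎))
  where open ≡-Reasoning

∉⇒≢ : ∀ {A : Set} {c x : A} {L : List A} → c ∉ L → x ∈ L → c ≢ x
∉⇒≢ c∉L x∈L refl = c∉L x∈L

length-map-++-map : ∀ {A B C : Set} (f : A → C) (g : B → C) xs ys →
                    length (map f xs ++ map g ys) ≡ length xs + length ys
length-map-++-map f g xs ys =
  trans (length-++ (map f xs)) (cong₂ _+_ (length-map f xs) (length-map g ys))

m<o⇒n<p⇒2+m+n≤o+p : ∀ {m n o p} → m < o → n < p → suc (suc (m + n)) ≤ o + p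
m<o⇒n<p⇒2+m+n≤o+p {m} {n} {o} {p} m<o n<p =
  subst (_≤ o + p) (cong suc (+-suc m n)) (+-mono-≤ m<o n<p)

sum-indicator≡length-filter : ∀ {A : Set} (p : A → Bool) xs →
  sum (map (λ x → if p x then 1 else 0) xs) ≡ length (filter (λ x → p x ≟ᵇ true) xs)
sum-indicator≡length-filter p []       = refl
sum-indicator≡length-filter p (x ∷ xs) with p x
... | true  = cong suc (sum-indicator≡length-filter p xs)
... | false = sum-indicator≡length-filter p xs

module _ {n} (G : Graph n) where

  Adj-sym : ∀ {x y} → Adj G x y → Adj G y x
  Adj-sym {x} {y} xy = trans (Graph.sym G y x) xy

  Adj-irrefl : ∀ {x} → ¬ Adj G x x
  Adj-irrefl {x} xx with () ← trans (≡.sym xx) (irrefl G x)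

  Adj⇒≢ : ∀ {x y} → Adj G x y → x ≢ y
  Adj⇒≢ xy refl = Adj-irrefl xy

  neighbours : Fin n → List (Fin n)
  neighbours x = filter (λ w → adj G x w ≟ᵇ true) (allFin n)

  deg≡length-neighbours : ∀ x → deg G x ≡ length (neighbours x)
  deg≡length-neighbours x = sum-indicator≡length-filter (adj G x) (allFin n)

  ∈-neighbours⁺ : ∀ {x w} → Adj G x w → w ∈ neighbours x
  ∈-neighbours⁺ {x} {w} xw = ∈-filter⁺ (λ w → adj G x w ≟ᵇ true) (∈-allFin w) xw

  neighboursExcept : Fin n → Fin n → List (Fin n)
  neighboursExcept x y = filter (λ w → ¬? (w ≟ y)) (neighbours x)

  ∈-neighboursExcept⁺ : ∀ {x y w} → Adj G x w → w ≢ y → w ∈ neighboursExcept x y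
  ∈-neighboursExcept⁺ {y = y} xw w≢y = ∈-filter⁺ (λ w → ¬? (w ≟ y)) (∈-neighbours⁺ xw) w≢y

  length-neighboursExcept< : ∀ {x y} → Adj G x y → length (neighboursExcept x y) < deg G x
  length-neighboursExcept< {x} {y} xy =
    subst (length (neighboursExcept x y) <_) (≡.sym (deg≡length-neighbours x))
      (filter-notAll (λ w → ¬? (w ≟ y)) (neighbours x)
        (Any.map (λ { refl w≢y → w≢y refl }) (∈-neighbours⁺ xy)))

module _ {n} (a b : Fin n) where

  sameEdge-refl : sameEdge a b a b ≡ true
  sameEdge-refl = to T-≡ (from T-∨ (inj₁ (from T-∧
    (fromWitness {a? = a ≟ a} refl , fromWitness {a? = b ≟ b} refl))))

  sameEdge-swap : sameEdge a b b a ≡ true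
  sameEdge-swap = trans (sameEdge-sym a b b a) sameEdge-refl

  sameEdge-false⇒≢ˡ : ∀ {w} → sameEdge a b a w ≡ false → w ≢ b
  sameEdge-false⇒≢ˡ e refl with () ← trans (≡.sym sameEdge-refl) e

  sameEdge-false⇒≢ʳ : ∀ {w} → sameEdge a b b w ≡ false → w ≢ a
  sameEdge-false⇒≢ʳ e refl with () ← trans (≡.sym sameEdge-swap) e

  sameEdge-true⁻ : ∀ {x y} → sameEdge a b x y ≡ true → (x ≡ a × y ≡ b) ⊎ (x ≡ b × y ≡ a)
  sameEdge-true⁻ {x} {y} e =
    Sum.map (witnesses (x ≟ a) (y ≟ b)) (witnesses (x ≟ b) (y ≟ a)) (to T-∨ (from T-≡ e))
    where
    witnesses : ∀ {P Q : Set} (p? : Dec P) (q? : Dec Q) → T (⌊ p? ⌋ ∧ ⌊ q? ⌋) → P × Q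
    witnesses p? q? t = Product.map (toWitness {a? = p?}) (toWitness {a? = q?}) (to T-∧ t)

module _ {n} (G : Graph n) {a b : Fin n} where

  Adj-deleteEdge⁺ : ∀ {x y} → Adj G x y → sameEdge a b x y ≡ false → Adj (deleteEdge G a b) x y
  Adj-deleteEdge⁺ xy e rewrite xy | e = refl

  Adj-deleteEdge⁻ : ∀ {x y} → Adj (deleteEdge G a b) x y → Adj G x y × sameEdge a b x y ≡ false
  Adj-deleteEdge⁻ {x} {y} h with adj G x y | sameEdge a b x y
  ... | true | false = refl , refl

  Adj-split : ∀ {x y} → Adj G x y →
              ((x ≡ a × y ≡ b) ⊎ (x ≡ b × y ≡ a)) ⊎ Adj (deleteEdge G a b) x y
  Adj-split {x} {y} xy with sameEdge a b x y ≟ᵇ true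
  ... | yes e  = inj₁ (sameEdge-true⁻ a b e)
  ... | no ¬e = inj₂ (Adj-deleteEdge⁺ xy (¬-not ¬e))

  ∈-neighboursExcept-deleteEdgeˡ : ∀ {w} → Adj (deleteEdge G a b) a w → w ∈ neighboursExcept G a b
  ∈-neighboursExcept-deleteEdgeˡ h with aw , e ← Adj-deleteEdge⁻ h =
    ∈-neighboursExcept⁺ G aw (sameEdge-false⇒≢ˡ a b e)

  ∈-neighboursExcept-deleteEdgeʳ : ∀ {w} → Adj (deleteEdge G a b) b w → w ∈ neighboursExcept G b a
  ∈-neighboursExcept-deleteEdgeʳ h with bw , e ← Adj-deleteEdge⁻ h =
    ∈-neighboursExcept⁺ G bw (sameEdge-false⇒≢ʳ a b e)

module _ {k n} {H : Graph n} (C : TotalColoring k H) (x : Fin n) (c : Fin k) where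
  open TotalColoring C

  recolouredVcol : Fin n → Fin k
  recolouredVcol = updateAt vcol x (const c)

  recolouredVcol-self : recolouredVcol x ≡ c
  recolouredVcol-self = updateAt-updates x vcol

  recolouredVcol-other : ∀ {y} → y ≢ x → recolouredVcol y ≡ vcol y
  recolouredVcol-other {y} = updateAt-minimal y x vcol

  recolourVertex : (∀ w → Adj H x w → c ≢ vcol w) → (∀ w → Adj H x w → c ≢ ecol x w) →
                   TotalColoring k H
  recolourVertex c∉vcol c∉ecol = record C
    { vcol = recolouredVcol ; vv-proper = vv-proper′ ; ve-proper = ve-proper′ }
    where
    recoloured : ∀ y → (y ≡ x × recolouredVcol y ≡ c) ⊎ recolouredVcol y ≡ vcol y
    recoloured y with y ≟ x
    ... | yes refl = inj₁ (refl , recolouredVcol-self)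
    ... | no y≢x  = inj₂ (recolouredVcol-other y≢x)

    vv-proper′ : ∀ y z → Adj H y z → recolouredVcol y ≢ recolouredVcol z
    vv-proper′ y z yz with recoloured y | recoloured z
    ... | inj₁ (refl , _) | inj₁ (refl , _) = ⊥-elim (Adj-irrefl H yz)
    ... | inj₁ (refl , p) | inj₂ q = subst₂ _≢_ (≡.sym p) (≡.sym q) (c∉vcol z yz)
    ... | inj₂ p | inj₁ (refl , q) = subst₂ _≢_ (≡.sym p) (≡.sym q) (≢-sym (c∉vcol y (Adj-sym H yz)))
    ... | inj₂ p | inj₂ q = subst₂ _≢_ (≡.sym p) (≡.sym q) (vv-proper y z yz)

    ve-proper′ : ∀ y z → Adj H y z → ecol y z ≢ recolouredVcol y
    ve-proper′ y z yz with recoloured y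
    ... | inj₁ (refl , p) = subst (ecol y z ≢_) (≡.sym p) (≢-sym (c∉ecol z yz))
    ... | inj₂ p = subst (ecol y z ≢_) (≡.sym p) (ve-proper y z yz)

module _ {k n} {G : Graph n} {a b : Fin n} (ab : Adj G a b)
         (C : TotalColoring k (deleteEdge G a b)) (c : Fin k) where
  open TotalColoring C

  private
    G-ab : Graph n
    G-ab = deleteEdge G a b

    ecol′ : Fin n → Fin n → Fin k
    ecol′ x y = if sameEdge a b x y then c else ecol x y

    ecol′-ab : ecol′ a b ≡ c
    ecol′-ab = cong (if_then c else ecol a b) (sameEdge-refl a b)

    ecol′-ba : ecol′ b a ≡ c
    ecol′-ba = cong (if_then c else ecol b a) (sameEdge-swap a b)

    ecol′-kept : ∀ {x y} → Adj G-ab x y → ecol′ x y ≡ ecol x y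
    ecol′-kept {x} {y} xy = cong (if_then c else ecol x y) (proj₂ (Adj-deleteEdge⁻ G xy))

  extendToDeletedEdge : vcol a ≢ vcol b → c ≢ vcol a → c ≢ vcol b →
                        (∀ w → Adj G-ab a w → c ≢ ecol a w) →
                        (∀ w → Adj G-ab b w → c ≢ ecol b w) →
                        TotalColoring k G
  extendToDeletedEdge va≢vb c≢va c≢vb c∉ecol-a c∉ecol-b = record
    { vcol = vcol ; ecol = ecol′
    ; ecol-sym = ecol-sym′ ; vv-proper = vv-proper′ ; ee-proper = ee-proper′ ; ve-proper = ve-proper′ }
    where
    ecol-sym′ : ∀ x y → Adj G x y → ecol′ x y ≡ ecol′ y x
    ecol-sym′ x y xy with Adj-split G {a} {b} xy
    ... | inj₁ (inj₁ (refl , refl)) = trans ecol′-ab (≡.sym ecol′-ba)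
    ... | inj₁ (inj₂ (refl , refl)) = trans ecol′-ba (≡.sym ecol′-ab)
    ... | inj₂ xy′ = begin
      ecol′ x y  ≡⟨ ecol′-kept xy′ ⟩
      ecol x y   ≡⟨ ecol-sym x y xy′ ⟩
      ecol y x   ≡⟨ ecol′-kept (Adj-sym G-ab xy′) ⟨
      ecol′ y x  ∎
      where open ≡-Reasoning

    vv-proper′ : ∀ x y → Adj G x y → vcol x ≢ vcol y
    vv-proper′ x y xy with Adj-split G {a} {b} xy
    ... | inj₁ (inj₁ (refl , refl)) = va≢vb
    ... | inj₁ (inj₂ (refl , refl)) = ≢-sym va≢vb
    ... | inj₂ xy′ = vv-proper x y xy′

    ve-proper′ : ∀ x y → Adj G x y → ecol′ x y ≢ vcol x
    ve-proper′ x y xy with Adj-split G {a} {b} xy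
    ... | inj₁ (inj₁ (refl , refl)) = subst (_≢ vcol a) (≡.sym ecol′-ab) c≢va
    ... | inj₁ (inj₂ (refl , refl)) = subst (_≢ vcol b) (≡.sym ecol′-ba) c≢vb
    ... | inj₂ xy′ = subst (_≢ vcol x) (≡.sym (ecol′-kept xy′)) (ve-proper x y xy′)

    new≢kept-a : ∀ {z} → Adj G-ab a z → ecol′ a b ≢ ecol′ a z
    new≢kept-a az = subst₂ _≢_ (≡.sym ecol′-ab) (≡.sym (ecol′-kept az)) (c∉ecol-a _ az)

    new≢kept-b : ∀ {z} → Adj G-ab b z → ecol′ b a ≢ ecol′ b z
    new≢kept-b bz = subst₂ _≢_ (≡.sym ecol′-ba) (≡.sym (ecol′-kept bz)) (c∉ecol-b _ bz)

    ee-proper′ : ∀ x y z → Adj G x y → Adj G x z → y ≢ z → ecol′ x y ≢ ecol′ x z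
    ee-proper′ x y z xy xz y≢z with Adj-split G {a} {b} xy | Adj-split G {a} {b} xz
    ... | inj₁ (inj₁ (refl , refl)) | inj₁ (inj₁ (_ , z≡b))   = ⊥-elim (y≢z (≡.sym z≡b))
    ... | inj₁ (inj₂ (refl , refl)) | inj₁ (inj₂ (_ , z≡a))   = ⊥-elim (y≢z (≡.sym z≡a))
    ... | inj₁ (inj₁ (refl , refl)) | inj₁ (inj₂ (a≡b , _))   = ⊥-elim (Adj⇒≢ G ab a≡b)
    ... | inj₁ (inj₂ (refl , refl)) | inj₁ (inj₁ (b≡a , _))   = ⊥-elim (Adj⇒≢ G ab (≡.sym b≡a))
    ... | inj₁ (inj₁ (refl , refl)) | inj₂ az = new≢kept-a az
    ... | inj₁ (inj₂ (refl , refl)) | inj₂ bz = new≢kept-b bz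
    ... | inj₂ ay | inj₁ (inj₁ (refl , refl)) = ≢-sym (new≢kept-a ay)
    ... | inj₂ by | inj₁ (inj₂ (refl , refl)) = ≢-sym (new≢kept-b by)
    ... | inj₂ xy′ | inj₂ xz′ =
      subst₂ _≢_ (≡.sym (ecol′-kept xy′)) (≡.sym (ecol′-kept xz′)) (ee-proper x y z xy′ xz′ y≢z)

module _ {k n} {G : Graph n} {u v : Fin n} (uv : Adj G u v)
         (C : TotalColoring k (deleteEdge G u v)) where
  open TotalColoring C

  private
    G-uv : Graph n
    G-uv = deleteEdge G u v

    Nu Nv : List (Fin n)
    Nu = neighboursExcept G u v
    Nv = neighboursExcept G v u

    ∈Nu : ∀ {w} → Adj G-uv u w → w ∈ Nu
    ∈Nu = ∈-neighboursExcept-deleteEdgeˡ G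

    ∈Nv : ∀ {w} → Adj G-uv v w → w ∈ Nv
    ∈Nv = ∈-neighboursExcept-deleteEdgeʳ G

    |Nu|<du : length Nu < deg G u
    |Nu|<du = length-neighboursExcept< G uv

    |Nv|<dv : length Nv < deg G v
    |Nv|<dv = length-neighboursExcept< G (Adj-sym G uv)

    forbiddenAtEdge : List (Fin k)
    forbiddenAtEdge = vcol v ∷ map (ecol u) Nu ++ map (ecol v) Nv

    forbiddenAtVertex : Fin k → List (Fin k)
    forbiddenAtVertex α = α ∷ vcol v ∷ map (ecol u) Nu ++ map vcol Nu

    length-forbiddenAtEdge< : deg G u + deg G v ≤ k → length forbiddenAtEdge < k
    length-forbiddenAtEdge< du+dv≤k rewrite length-map-++-map (ecol u) (ecol v) Nu Nv =
      ≤-trans (m<o⇒n<p⇒2+m+n≤o+p |Nu|<du |Nv|<dv) du+dv≤k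

    length-forbiddenAtVertex< : deg G u + deg G u < k → ∀ α → length (forbiddenAtVertex α) < k
    length-forbiddenAtVertex< 2du<k α rewrite length-map-++-map (ecol u) vcol Nu Nu =
      ≤-trans (s≤s (m<o⇒n<p⇒2+m+n≤o+p |Nu|<du |Nu|<du)) 2du<k

  freeEdgeColour : deg G u + deg G v ≤ k →
                   ∃ λ α → α ≢ vcol v × (∀ w → Adj G-uv u w → α ≢ ecol u w)
                                      × (∀ w → Adj G-uv v w → α ≢ ecol v w)
  freeEdgeColour du+dv≤k
    with α , α∉ ← unusedColour forbiddenAtEdge (length-forbiddenAtEdge< du+dv≤k)
    = α , ∉⇒≢ α∉ (here refl)
        , (λ w uw → ∉⇒≢ α∉ (there (∈-++⁺ˡ (∈-map⁺ (ecol u) (∈Nu uw)))))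
        , (λ w vw → ∉⇒≢ α∉ (there (∈-++⁺ʳ _ (∈-map⁺ (ecol v) (∈Nv vw)))))

  freeVertexColour : deg G u + deg G u < k → (α : Fin k) →
                     ∃ λ β → β ≢ α × β ≢ vcol v × (∀ w → Adj G-uv u w → β ≢ vcol w)
                                                × (∀ w → Adj G-uv u w → β ≢ ecol u w)
  freeVertexColour 2du<k α
    with β , β∉ ← unusedColour (forbiddenAtVertex α) (length-forbiddenAtVertex< 2du<k α)
    = β , ∉⇒≢ β∉ (here refl) , ∉⇒≢ β∉ (there (here refl))
        , (λ w uw → ∉⇒≢ β∉ (there (there (∈-++⁺ʳ _ (∈-map⁺ vcol (∈Nu uw))))))
        , (λ w uw → ∉⇒≢ β∉ (there (there (∈-++⁺ˡ (∈-map⁺ (ecol u) (∈Nu uw))))))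

  extendAcrossLightEdge : deg G u + deg G u < k → deg G u + deg G v ≤ k → TotalColoring k G
  extendAcrossLightEdge 2du<k du+dv≤k
    with α , α≢vcol-v , α∉ecol-u , α∉ecol-v ← freeEdgeColour du+dv≤k
    with β , β≢α , β≢vcol-v , β∉vcol , β∉ecol ← freeVertexColour 2du<k α
    = extendToDeletedEdge uv C′ α vcol′u≢vcol′v
        (subst (α ≢_) (≡.sym vcol′u≡β) (≢-sym β≢α))
        (subst (α ≢_) (≡.sym vcol′v≡vcol-v) α≢vcol-v)
        α∉ecol-u α∉ecol-v
    where
    C′ : TotalColoring k G-uv
    C′ = recolourVertex C u β β∉vcol β∉ecol

    vcol′ : Fin n → Fin k
    vcol′ = recolouredVcol C u β

    vcol′u≡β : vcol′ u ≡ β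
    vcol′u≡β = recolouredVcol-self C u β

    vcol′v≡vcol-v : vcol′ v ≡ vcol v
    vcol′v≡vcol-v = recolouredVcol-other C u β (≢-sym (Adj⇒≢ G uv))

    vcol′u≢vcol′v : vcol′ u ≢ vcol′ v
    vcol′u≢vcol′v = subst₂ _≢_ (≡.sym vcol′u≡β) (≡.sym vcol′v≡vcol-v) β≢vcol-v

lemma2p3 : ∀ {n} (G : Graph n) → MinimalCounterexample G
             → ∀ (u v : Fin n) → Adj G u v → deg G u ≤ 4 → 10 ≤ deg G u + deg G v
lemma2p3 G M u v uv du≤4 = ≰⇒> λ du+dv≤9 →
  notColorable (extendAcrossLightEdge uv (edgeDeletion u v uv) (s≤s (+-mono-≤ du≤4 du≤4)) du+dv≤9)
  where open MinimalCounterexample M
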